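{- Let $X$ be a multigraph with maximum valency $d>2$, and let $D$ be the chromatic index of the complete generalized truncation of $X$. Then for every integer $k$ with $3\leq k\leq D$ there is a cohesive generalized truncation of $X$ with chromatic index $k$.
   Context: A multigraph may have multiple edges but no loops; it is assumed to have no isolated vertices. Generalized truncation of $X$: take a matching $M_0$ with $|M_0|=|E(X)|$ (on $2|E(X)|$ new vertices) and a bijection $F:E(X)\to M_0$; for each edge $e$ of $X$ with ends $u,v$, label one end of $F(e)$ by $u$ and the other by $v$. For $v\in V(X)$, the cluster $\mathrm{cl}(v)$ is the set of vertices labelled $v$; insert an arbitrary graph $\mathrm{con}(v)$ (constituent) on $\mathrm{cl}(v)$. The result is a generalized truncation of $X$; it is cohesive if every constituent is connected, and it is the complete generalized truncation if every constituent is a complete graph. The chromatic index is the minimum number of colors in a proper edge coloring. -}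

module Defs where

open import Data.Nat using (ℕ; zero; suc; _+_; _≤_; _<_)
open import Data.Fin using (Fin)
open import Data.Fin.Properties using () renaming (_≟_ to _≟F_)
open import Data.Bool using (Bool; true; false; _∧_; _∨_; not; _xor_)
open import Data.Bool.Properties using () renaming (_≟_ to _≟B_)
open import Data.Product using (Σ; ∃; _×_; _,_; proj₁; proj₂)
open import Data.Product.Properties using (≡-dec)
open import Data.Sum using (_⊎_)
open import Data.List using (List; map; allFin)
open import Data.Nat.ListAction using (sum)
open import Relation.Nullary using (¬_)
open import Relation.Nullary.Decidable using (⌊_⌋)
open import Relation.Binary.PropositionalEquality using (_≡_; _≢_; refl; sym; cong; cong₂)
open import Data.Empty using (⊥-elim)

record Multigraph : Set where
  field
    n m        : ℕ
    end₁ end₂  : Fin m → Fin n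
    noLoop     : ∀ e → end₁ e ≢ end₂ e
    noIsolated : ∀ v → ∃ λ e → (end₁ e ≡ v) ⊎ (end₂ e ≡ v)

open Multigraph public

δ : {n : ℕ} → Fin n → Fin n → ℕ
δ u v with u ≟F v
... | Relation.Nullary.yes _ = 1
... | Relation.Nullary.no  _ = 0

valency : (X : Multigraph) → Fin (n X) → ℕ
valency X v = sum (map (λ e → δ (end₁ X e) v + δ (end₂ X e) v) (allFin (m X)))

MaxValency : Multigraph → ℕ → Set
MaxValency X d = (∀ v → valency X v ≤ d) × (∃ λ v → valency X v ≡ d)

record Graph : Set₁ where
  field
    V        : Set
    adj      : V → V → Bool
    adj-sym  : ∀ x y → adj x y ≡ adj y x
    adj-irr  : ∀ x → adj x x ≡ false

open Graph public

record EdgeColouring (G : Graph) (k : ℕ) : Set where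
  field
    colour     : V G → V G → Fin k
    colour-sym : ∀ x y → adj G x y ≡ true → colour x y ≡ colour y x
    proper     : ∀ x y z → y ≢ z → adj G x y ≡ true → adj G x z ≡ true →
                 colour x y ≢ colour x z

ChromaticIndex : Graph → ℕ → Set
ChromaticIndex G k = EdgeColouring G k × (∀ j → j < k → ¬ EdgeColouring G j)

-- Generalized truncations.
-- The matching M₀ has vertex set  Fin m × Bool : the edge F(e) joins
-- (e , false) (labelled end₁ e) and (e , true) (labelled end₂ e).

TVert : Multigraph → Set
TVert X = Fin (m X) × Bool

label : (X : Multigraph) → TVert X → Fin (n X)
label X (e , false) = end₁ X e
label X (e , true)  = end₂ X e

_≟T_ : {X : Multigraph} → (x y : TVert X) → Relation.Nullary.Dec (x ≡ y)
_≟T_ = ≡-dec _≟F_ _≟B_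

matchAdj : (X : Multigraph) → TVert X → TVert X → Bool
matchAdj X (e , b) (e' , b') = ⌊ e ≟F e' ⌋ ∧ (b xor b')

-- A choice of constituents: a simple graph on each cluster cl(v),
-- encoded as one adjacency relation whose edges stay inside clusters.
record Constituents (X : Multigraph) : Set where
  field
    con       : TVert X → TVert X → Bool
    con-sym   : ∀ x y → con x y ≡ con y x
    con-irr   : ∀ x → con x x ≡ false
    con-inside : ∀ x y → con x y ≡ true → label X x ≡ label X y

open Constituents public

data Reach {X : Multigraph} (C : Constituents X) : TVert X → TVert X → Set where
  here : ∀ {x} → Reach C x x
  step : ∀ {x y z} → con C x y ≡ true → Reach C y z → Reach C x z

Cohesive : {X : Multigraph} → Constituents X → Set
Cohesive {X} C = ∀ x y → label X x ≡ label X y → Reach C x y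

truncAdj : (X : Multigraph) → Constituents X → TVert X → TVert X → Bool
truncAdj X C x y = matchAdj X x y ∨ con C x y


⌊≟⌋-sym : ∀ {A : Set} (d : (a b : A) → Relation.Nullary.Dec (a ≡ b)) (a b : A) →
          ⌊ d a b ⌋ ≡ ⌊ d b a ⌋
⌊≟⌋-sym d a b with d a b | d b a
... | Relation.Nullary.yes _ | Relation.Nullary.yes _ = refl
... | Relation.Nullary.no _  | Relation.Nullary.no _  = refl
... | Relation.Nullary.yes p | Relation.Nullary.no q  = ⊥-elim (q (sym p))
... | Relation.Nullary.no p  | Relation.Nullary.yes q = ⊥-elim (p (sym q))

xor-comm : ∀ a b → a xor b ≡ b xor a
xor-comm false false = refl
xor-comm false true  = refl
xor-comm true  false = refl
xor-comm true  true  = refl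

xor-self : ∀ a → a xor a ≡ false
xor-self false = refl
xor-self true  = refl

∧-false : ∀ a → a ∧ false ≡ false
∧-false false = refl
∧-false true  = refl

matchAdj-sym : (X : Multigraph) → ∀ x y → matchAdj X x y ≡ matchAdj X y x
matchAdj-sym X (e , b) (e' , b') = cong₂ _∧_ (⌊≟⌋-sym _≟F_ e e') (xor-comm b b')

matchAdj-irr : (X : Multigraph) → ∀ x → matchAdj X x x ≡ false
matchAdj-irr X (e , b) rewrite xor-self b = ∧-false _

truncation : (X : Multigraph) → Constituents X → Graph
truncation X C = record
  { V       = TVert X
  ; adj     = truncAdj X C
  ; adj-sym = λ x y → cong₂ _∨_ (matchAdj-sym X x y) (con-sym C x y)
  ; adj-irr = λ x → cong₂ _∨_ (matchAdj-irr X x) (con-irr C x)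
  }

completeCon : (X : Multigraph) → TVert X → TVert X → Bool
completeCon X x y = ⌊ label X x ≟F label X y ⌋ ∧ not ⌊ _≟T_ {X} x y ⌋

completeCon-inside : (X : Multigraph) → ∀ x y → completeCon X x y ≡ true →
                     label X x ≡ label X y
completeCon-inside X x y h with label X x ≟F label X y
... | Relation.Nullary.yes p = p
completeCon-inside X x y () | Relation.Nullary.no _

completeCon-irr : (X : Multigraph) → ∀ x → completeCon X x x ≡ false
completeCon-irr X x with _≟T_ {X} x x
... | Relation.Nullary.yes _ = ∧-false _
... | Relation.Nullary.no ¬p = ⊥-elim (¬p refl)

complete : (X : Multigraph) → Constituents X
complete X = record
  { con        = completeCon X
  ; con-sym    = λ x y → cong₂ _∧_ (⌊≟⌋-sym _≟F_ (label X x) (label X y))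
                                   (cong not (⌊≟⌋-sym (_≟T_ {X}) x y))
  ; con-irr    = completeCon-irr X
  ; con-inside = completeCon-inside X
  }

completeTruncation : Multigraph → Graph
completeTruncation X = truncation X (complete X)

-- Number the cluster cl(v) as 0, 1, …, valency(v) − 1.  For 3 ≤ k ≤ d take as every constituent
-- the broom with k − 1 spokes: the root 0 joined to 1, …, k − 1, followed by the path
-- k − 1, k, k + 1, ….  It is connected, and it is properly edge-coloured by k − 1 colours (the
-- spokes get distinct colours, the tail alternates between two of them), so with one more colour
-- for M₀ the truncation is k-colourable, while the root of a cluster of valency d has k neighbours
-- (its k − 1 spokes and its M₀-partner).
-- For k > d, colouring the edge {i, j} of each complete constituent by i + j mod d shows D ≤ d + 1,
-- so k = D and the complete truncation itself will do.

module Submission where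

open import Defs
open import Data.Nat using (ℕ; zero; suc; _+_; _∸_; _≤_; _<_; _⊔_; z≤n; s≤s; NonZero; _%_)
open import Data.Nat.Properties
open import Data.Nat.DivMod using (_mod_; m%n<n; m<n⇒m%n≡m; m%n%n≡m%n; %-distribˡ-+; [m+n]%n≡m%n)
open import Data.Nat.Induction using (<-wellFounded)
open import Induction.WellFounded using (Acc; acc)
open import Data.Fin using (Fin; toℕ; zero; suc)
open import Data.Fin.Properties
  using (pigeonhole; toℕ-fromℕ<; toℕ-injective; toℕ<n)
  renaming (_≟_ to _≟ᶠ_; <-cmp to <-cmpᶠ; <⇒≢ to <⇒≢ᶠ; suc-injective to suc-injectiveᶠ)
open import Data.Bool using (true; false; not; _∨_; if_then_else_)
open import Data.Bool.Properties using (∨-zeroʳ)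
open import Data.Product using (Σ; ∃; _×_; _,_; proj₁; proj₂)
import Data.Product as Product
open import Data.Sum using (_⊎_; inj₁; inj₂)
open import Data.List using (tabulate)
open import Data.List.Properties using (map-tabulate)
open import Data.Nat.ListAction using (sum)
open import Data.Empty using (⊥; ⊥-elim)
open import Function using (_∘_; id; mk⇔)
open import Function.Definitions using (Injective)
open import Relation.Nullary using (¬_; Dec; yes; no; does)
open import Relation.Nullary.Decidable using (_×-dec_; _⊎-dec_; dec-true; dec-false; does-⇔)
open import Relation.Binary.Definitions using (Decidable; Symmetric; tri<; tri≈; tri>)
open import Relation.Binary.PropositionalEquality
open ≡-Reasoning

does-true : ∀ {A : Set} (a? : Dec A) → does a? ≡ true → A
does-true (yes a) _ = a
does-true (no _) ()

Reach-trans : ∀ {X} {C : Constituents X} {x y z} → Reach C x y → Reach C y z → Reach C x z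
Reach-trans here       q = q
Reach-trans (step c p) q = step c (Reach-trans p q)

Reach-sym : ∀ {X} {C : Constituents X} {x y} → Reach C x y → Reach C y x
Reach-sym here = here
Reach-sym {C = C} (step {x} {y} c p) =
  Reach-trans (Reach-sym p) (step (trans (con-sym C y x) c) here)

colouring-needs-degree : (G : Graph) {k : ℕ} (x : V G) (nb : Fin k → V G) →
  Injective _≡_ _≡_ nb → (∀ i → adj G x (nb i) ≡ true) →
  ∀ j → j < k → ¬ EdgeColouring G j
colouring-needs-degree G x nb nb-injective adjacent j j<k κ
  with i , i′ , i<i′ , same ← pigeonhole j<k (λ i → EdgeColouring.colour κ x (nb i))
  = EdgeColouring.proper κ x (nb i) (nb i′) (<⇒≢ᶠ i<i′ ∘ nb-injective) (adjacent i) (adjacent i′) same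

prefixSum : ∀ {m} → (Fin m → ℕ) → Fin m → ℕ
prefixSum h zero    = 0
prefixSum h (suc e) = h zero + prefixSum (h ∘ suc) e

prefixSum-<-sum : ∀ {m} (h : Fin m → ℕ) {e} → 0 < h e → prefixSum h e < sum (tabulate h)
prefixSum-<-sum h {zero}  0<h = ≤-trans 0<h (m≤m+n _ _)
prefixSum-<-sum h {suc e} 0<h = +-monoʳ-< (h zero) (prefixSum-<-sum (h ∘ suc) 0<h)

prefixSum-<-on-support : ∀ {m} (h : Fin m → ℕ) {e e′} → toℕ e < toℕ e′ → 0 < h e →
                         prefixSum h e < prefixSum h e′
prefixSum-<-on-support h {zero}  {suc e′} _         0<h = ≤-trans 0<h (m≤m+n _ _)
prefixSum-<-on-support h {suc e} {suc e′} (s≤s e<e′) 0<h =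
  +-monoʳ-< (h zero) (prefixSum-<-on-support (h ∘ suc) e<e′ 0<h)

prefixSum-injective-on-support : ∀ {m} (h : Fin m → ℕ) {e e′} → 0 < h e → 0 < h e′ →
                                 prefixSum h e ≡ prefixSum h e′ → e ≡ e′
prefixSum-injective-on-support h {e} {e′} 0<h 0<h′ same with <-cmpᶠ e e′
... | tri< e<e′ _ _ = ⊥-elim (<-irrefl same (prefixSum-<-on-support h e<e′ 0<h))
... | tri≈ _ e≡e′ _ = e≡e′
... | tri> _ _ e′<e = ⊥-elim (<-irrefl (sym same) (prefixSum-<-on-support h e′<e 0<h′))

prefixSum-surjective : ∀ {m} (h : Fin m → ℕ) → (∀ e → h e ≤ 1) →
                       ∀ {i} → i < sum (tabulate h) → ∃ λ e → 0 < h e × prefixSum h e ≡ i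
prefixSum-surjective {zero}  h h≤1 ()
prefixSum-surjective {suc m} h h≤1 {i} i<sum with h zero in h₀ | h≤1 zero
... | 0 | _ with (e , 0<h , e↦i) ← prefixSum-surjective (h ∘ suc) (h≤1 ∘ suc) i<sum =
  suc e , 0<h , trans (cong (_+ prefixSum (h ∘ suc) e) h₀) e↦i
... | 1 | _ with i | i<sum
...   | zero  | _ = zero , ≤-reflexive (sym h₀) , refl
...   | suc i | s≤s i<sum′ with (e , 0<h , e↦i) ← prefixSum-surjective (h ∘ suc) (h≤1 ∘ suc) i<sum′ =
  suc e , 0<h , trans (cong (_+ prefixSum (h ∘ suc) e) h₀) (cong suc e↦i)
prefixSum-surjective {suc m} h h≤1 i<sum | suc (suc _) | s≤s ()

module ClusterIndex (X : Multigraph) where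

  endsAt : Fin (n X) → Fin (m X) → ℕ
  endsAt v e = δ (end₁ X e) v + δ (end₂ X e) v

  valency≡sum : ∀ v → valency X v ≡ sum (tabulate (endsAt v))
  valency≡sum v = cong sum (map-tabulate id (endsAt v))

  endsAt≤1 : ∀ v e → endsAt v e ≤ 1
  endsAt≤1 v e with end₁ X e ≟ᶠ v | end₂ X e ≟ᶠ v
  ... | yes e₁≡v | yes e₂≡v = ⊥-elim (noLoop X e (trans e₁≡v (sym e₂≡v)))
  ... | yes _    | no _     = ≤-refl
  ... | no _     | yes _    = ≤-refl
  ... | no _     | no _     = z≤n

  endsAt-label : ∀ x → 0 < endsAt (label X x) (proj₁ x)
  endsAt-label (e , false) with end₁ X e ≟ᶠ end₁ X e
  ... | yes _  = s≤s z≤n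
  ... | no ¬eq = ⊥-elim (¬eq refl)
  endsAt-label (e , true) with end₂ X e ≟ᶠ end₂ X e
  ... | yes _  = m≤n+m 1 _
  ... | no ¬eq = ⊥-elim (¬eq refl)

  endsAt-positive : ∀ v e → 0 < endsAt v e → ∃ λ b → label X (e , b) ≡ v
  endsAt-positive v e 0<ends with end₁ X e ≟ᶠ v | end₂ X e ≟ᶠ v
  ... | yes e₁≡v | _        = false , e₁≡v
  ... | no _     | yes e₂≡v = true , e₂≡v
  endsAt-positive v e () | no _ | no _

  label-injectiveʳ : ∀ e {b b′} → label X (e , b) ≡ label X (e , b′) → b ≡ b′
  label-injectiveʳ e {false} {false} _  = refl
  label-injectiveʳ e {false} {true}  eq = ⊥-elim (noLoop X e eq)
  label-injectiveʳ e {true}  {false} eq = ⊥-elim (noLoop X e (sym eq))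
  label-injectiveʳ e {true}  {true}  _  = refl

  index : TVert X → ℕ
  index x = prefixSum (endsAt (label X x)) (proj₁ x)

  index<valency : ∀ x → index x < valency X (label X x)
  index<valency x = subst (index x <_) (sym (valency≡sum (label X x)))
    (prefixSum-<-sum (endsAt (label X x)) (endsAt-label x))

  index-injective : ∀ x y → label X x ≡ label X y → index x ≡ index y → x ≡ y
  index-injective x@(e , b) y@(e′ , b′) same-label same-index
    with refl ← prefixSum-injective-on-support (endsAt (label X x)) (endsAt-label x)
                  (subst (λ v → 0 < endsAt v e′) (sym same-label) (endsAt-label y))
                  (trans same-index (cong (λ v → prefixSum (endsAt v) e′) (sym same-label)))
    = cong (e ,_) (label-injectiveʳ e same-label)

  index-surjective : ∀ v {i} → i < valency X v → ∃ λ x → label X x ≡ v × index x ≡ i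
  index-surjective v i<valency
    with e , 0<ends , e↦i ← prefixSum-surjective (endsAt v) (endsAt≤1 v)
                               (subst (_ <_) (valency≡sum v) i<valency)
    with b , eb↦v ← endsAt-positive v e 0<ends
    = (e , b) , eb↦v , subst (λ w → prefixSum (endsAt w) e ≡ _) (sym eb↦v) e↦i

module Matching (X : Multigraph) where

  partner : TVert X → TVert X
  partner (e , b) = e , not b

  label-partner : ∀ x → label X (partner x) ≢ label X x
  label-partner (e , false) eq = noLoop X e (sym eq)
  label-partner (e , true)  eq = noLoop X e eq

  matchAdj-partner : ∀ x → matchAdj X x (partner x) ≡ true
  matchAdj-partner (e , b) with e ≟ᶠ e
  matchAdj-partner (e , false) | yes _  = refl
  matchAdj-partner (e , true)  | yes _  = refl
  matchAdj-partner (e , b)     | no ¬eq = ⊥-elim (¬eq refl)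

  matchAdj⇒partner : ∀ x y → matchAdj X x y ≡ true → y ≡ partner x
  matchAdj⇒partner (e , b) (e′ , b′) match with e ≟ᶠ e′
  matchAdj⇒partner (e , false) (.e , true)  _ | yes refl = refl
  matchAdj⇒partner (e , true)  (.e , false) _ | yes refl = refl
  matchAdj⇒partner (e , false) (.e , false) () | yes refl
  matchAdj⇒partner (e , true)  (.e , true)  () | yes refl
  matchAdj⇒partner _ _ () | no _

mod-injective : ∀ {a b t} .{{_ : NonZero t}} → a < t → b < t → a mod t ≡ b mod t → a ≡ b
mod-injective {a} {b} {t} a<t b<t same = begin
  a             ≡⟨ m<n⇒m%n≡m a<t ⟨
  a % t         ≡⟨ toℕ-fromℕ< (m%n<n a t) ⟨
  toℕ (a mod t) ≡⟨ cong toℕ same ⟩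
  toℕ (b mod t) ≡⟨ toℕ-fromℕ< (m%n<n b t) ⟩
  b % t         ≡⟨ m<n⇒m%n≡m b<t ⟩
  b             ∎

record ConstituentColouring {X : Multigraph} (C : Constituents X) (t : ℕ) : Set where
  field
    colour     : TVert X → TVert X → ℕ
    colour-sym : ∀ x y → colour x y ≡ colour y x
    colour<    : ∀ x y → con C x y ≡ true → colour x y < t
    proper     : ∀ x y z → y ≢ z → con C x y ≡ true → con C x z ≡ true → colour x y ≢ colour x z

truncationColouring : ∀ {X} {C : Constituents X} {t} .{{_ : NonZero t}} →
                      ConstituentColouring C t → EdgeColouring (truncation X C) (suc t)
truncationColouring {X} {C} {t} κ = record
  { colour     = colour′
  ; colour-sym = λ x y _ → colour′-sym x y
  ; proper     = proper′
  }
  where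
  open ConstituentColouring κ
  open Matching X using (matchAdj⇒partner)

  colour′ : TVert X → TVert X → Fin (suc t)
  colour′ x y = if matchAdj X x y then zero else suc (colour x y mod t)

  colour′-sym : ∀ x y → colour′ x y ≡ colour′ y x
  colour′-sym x y rewrite matchAdj-sym X x y | colour-sym x y = refl

  proper′ : ∀ x y z → y ≢ z → truncAdj X C x y ≡ true → truncAdj X C x z ≡ true →
            colour′ x y ≢ colour′ x z
  proper′ x y z y≢z xy xz with matchAdj X x y in mxy | matchAdj X x z in mxz
  ... | true  | true  = λ _ → y≢z (trans (matchAdj⇒partner x y mxy) (sym (matchAdj⇒partner x z mxz)))
  ... | true  | false = λ ()
  ... | false | true  = λ ()
  ... | false | false = proper x y z y≢z xy xz ∘ mod-injective (colour< x y xy) (colour< x z xz) ∘ suc-injectiveᶠ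

[m%n+k]%n≡[m+k]%n : ∀ m k n .{{_ : NonZero n}} → (m % n + k) % n ≡ (m + k) % n
[m%n+k]%n≡[m+k]%n m k n = begin
  (m % n + k) % n         ≡⟨ %-distribˡ-+ (m % n) k n ⟩
  (m % n % n + k % n) % n ≡⟨ cong (λ r → (r + k % n) % n) (m%n%n≡m%n m n) ⟩
  (m % n + k % n) % n     ≡⟨ %-distribˡ-+ m k n ⟨
  (m + k) % n             ∎

[[i+j]%n+[n∸i]]%n≡j : ∀ {i j n} .{{_ : NonZero n}} → i ≤ n → j < n → ((i + j) % n + (n ∸ i)) % n ≡ j
[[i+j]%n+[n∸i]]%n≡j {i} {j} {n} i≤n j<n = begin
  ((i + j) % n + (n ∸ i)) % n ≡⟨ [m%n+k]%n≡[m+k]%n (i + j) (n ∸ i) n ⟩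
  (i + j + (n ∸ i)) % n       ≡⟨ cong (_% n) i+j+[n∸i]≡j+n ⟩
  (j + n) % n                 ≡⟨ [m+n]%n≡m%n j n ⟩
  j % n                       ≡⟨ m<n⇒m%n≡m j<n ⟩
  j                           ∎
  where
  i+j+[n∸i]≡j+n : i + j + (n ∸ i) ≡ j + n
  i+j+[n∸i]≡j+n = begin
    i + j + (n ∸ i)   ≡⟨ cong (_+ (n ∸ i)) (+-comm i j) ⟩
    j + i + (n ∸ i)   ≡⟨ +-assoc j i (n ∸ i) ⟩
    j + (i + (n ∸ i)) ≡⟨ cong (j +_) (m+[n∸m]≡n i≤n) ⟩
    j + n             ∎

+-%-cancelˡ : ∀ {i j j′ n} .{{_ : NonZero n}} → i ≤ n → j < n → j′ < n →
              (i + j) % n ≡ (i + j′) % n → j ≡ j′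
+-%-cancelˡ {i} {j} {j′} {n} i≤n j<n j′<n same = begin
  j                            ≡⟨ [[i+j]%n+[n∸i]]%n≡j i≤n j<n ⟨
  ((i + j) % n + (n ∸ i)) % n  ≡⟨ cong (λ r → (r + (n ∸ i)) % n) same ⟩
  ((i + j′) % n + (n ∸ i)) % n ≡⟨ [[i+j]%n+[n∸i]]%n≡j i≤n j′<n ⟩
  j′                           ∎

completeTruncation-colouring : ∀ X {d} .{{_ : NonZero d}} → (∀ v → valency X v ≤ d) →
                               EdgeColouring (completeTruncation X) (suc d)
completeTruncation-colouring X {d} valency≤d = truncationColouring {C = complete X} record
  { colour     = λ x y → (index x + index y) % d
  ; colour-sym = λ x y → cong (_% d) (+-comm (index x) (index y))
  ; colour<    = λ x y _ → m%n<n (index x + index y) d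
  ; proper     = proper
  }
  where
  open ClusterIndex X

  index<d : ∀ x → index x < d
  index<d x = ≤-trans (index<valency x) (valency≤d (label X x))

  proper : ∀ x y z → y ≢ z → con (complete X) x y ≡ true → con (complete X) x z ≡ true →
           (index x + index y) % d ≢ (index x + index z) % d
  proper x y z y≢z xy xz = y≢z ∘ index-injective y z same-label ∘
    +-%-cancelˡ (<⇒≤ (index<d x)) (index<d y) (index<d z)
    where
    same-label : label X y ≡ label X z
    same-label = trans (sym (completeCon-inside X x y xy)) (completeCon-inside X x z xz)

complete-cohesive : ∀ X → Cohesive (complete X)
complete-cohesive X x y same-label with _≟T_ {X} x y
... | yes refl = here
... | no x≢y   = step adjacent here
  where
  adjacent : completeCon X x y ≡ true
  adjacent with label X x ≟ᶠ label X y | _≟T_ {X} x y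
  ... | yes _    | no _     = refl
  ... | _        | yes x≡y  = ⊥-elim (x≢y x≡y)
  ... | no ¬same | _        = ⊥-elim (¬same same-label)

module IndexConstituents (X : Multigraph) {R : ℕ → ℕ → Set} (R? : Decidable R)
                         (R-sym : Symmetric R) (R-irrefl : ∀ i → ¬ R i i) where

  open ClusterIndex X

  Linked : TVert X → TVert X → Set
  Linked x y = label X x ≡ label X y × R (index x) (index y)

  linked? : ∀ x y → Dec (Linked x y)
  linked? x y = label X x ≟ᶠ label X y ×-dec R? (index x) (index y)

  constituents : Constituents X
  constituents = record
    { con        = λ x y → does (linked? x y)
    ; con-sym    = λ x y → does-⇔ (mk⇔ (swap {x} {y}) (swap {y} {x})) (linked? x y) (linked? y x)
    ; con-irr    = λ x → dec-false (linked? x x) (R-irrefl (index x) ∘ proj₂)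
    ; con-inside = λ x y → proj₁ ∘ does-true (linked? x y)
    }
    where
    swap : ∀ {x y} → Linked x y → Linked y x
    swap = Product.map sym R-sym

  module _ (descend : ∀ i → 0 < i → ∃ λ j → j < i × R i j) where

    reach-index0 : ∀ z → index z ≡ 0 → ∀ w → label X w ≡ label X z → Acc _<_ (index w) →
                   Reach constituents w z
    reach-index0 z iz w same (acc smaller) with index w in iw
    ... | zero with refl ← index-injective w z same (trans iw (sym iz)) = here
    ... | suc i with j , j<i , r ← descend (suc i) (s≤s z≤n)
                with u , lu , iu ← index-surjective (label X w)
                                     (<-trans j<i (subst (_< valency X (label X w)) iw (index<valency w)))
                = step (dec-true (linked? w u) (sym lu , subst₂ R (sym iw) (sym iu) r))
                       (reach-index0 z iz u (trans lu same) (smaller (subst (_< suc i) (sym iu) j<i)))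

    cohesive : Cohesive constituents
    cohesive x y same-label
      with z , lz , iz ← index-surjective (label X x) (≤-trans (s≤s z≤n) (index<valency x))
      = Reach-trans (reach-index0 z iz x (sym lz) (<-wellFounded _))
                    (Reach-sym (reach-index0 z iz y (trans (sym same-label) (sym lz)) (<-wellFounded _)))

  colouring : ∀ {t} (κ : ℕ → ℕ → ℕ) → (∀ i j → κ i j ≡ κ j i) → (∀ {i j} → R i j → κ i j < t) →
              (∀ {i j j′} → R i j → R i j′ → j ≢ j′ → κ i j ≢ κ i j′) →
              ConstituentColouring constituents t
  colouring κ κ-sym κ< κ-proper = record
    { colour     = λ x y → κ (index x) (index y)
    ; colour-sym = λ x y → κ-sym (index x) (index y)
    ; colour<    = λ x y xy → κ< (proj₂ (does-true (linked? x y) xy))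
    ; proper     = proper
    }
    where
    proper : ∀ x y z → y ≢ z → does (linked? x y) ≡ true → does (linked? x z) ≡ true →
             κ (index x) (index y) ≢ κ (index x) (index z)
    proper x y z y≢z xy xz
      with lxy , rxy ← does-true (linked? x y) xy
      with lxz , rxz ← does-true (linked? x z) xz
      = κ-proper rxy rxz (y≢z ∘ index-injective y z (trans (sym lxy) lxz))

module Broom (s : ℕ) where

  spokes : ℕ
  spokes = suc (suc s)

  -- parent c is the parent of c + 1: the spokes 1, …, spokes hang off the root 0,
  -- and from the last spoke on the broom continues as the path spokes, spokes + 1, ….
  parent : ℕ → ℕ
  parent c with c <? spokes
  ... | yes _ = 0
  ... | no _  = c

  Child : ℕ → ℕ → Set
  Child zero    p = ⊥
  Child (suc c) p = parent c ≡ p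

  child? : Decidable Child
  child? zero    p = no λ ()
  child? (suc c) p = parent c ≟ p

  parent≤ : ∀ c → parent c ≤ c
  parent≤ c with c <? spokes
  ... | yes _ = z≤n
  ... | no _  = ≤-refl

  Child⇒< : ∀ {c p} → Child c p → p < c
  Child⇒< {suc c} refl = s≤s (parent≤ c)

  Child-unique : ∀ {c p p′} → Child c p → Child c p′ → p ≡ p′
  Child-unique {suc c} refl refl = refl

  spoke : ∀ {c} → c < spokes → Child (suc c) 0
  spoke {c} c<spokes with c <? spokes
  ... | yes _         = refl
  ... | no c≮spokes   = ⊥-elim (c≮spokes c<spokes)

  Child⇒tail : ∀ {c p} → Child (suc c) (suc p) → c ≡ suc p × spokes ≤ c
  Child⇒tail {c} child with c <? spokes
  Child⇒tail () | yes _
  Child⇒tail refl | no c≮spokes = refl , ≮⇒≥ c≮spokes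

  Edge : ℕ → ℕ → Set
  Edge i j = Child i j ⊎ Child j i

  edge? : Decidable Edge
  edge? i j = child? i j ⊎-dec child? j i

  edge-sym : Symmetric Edge
  edge-sym (inj₁ c) = inj₂ c
  edge-sym (inj₂ c) = inj₁ c

  edge-irrefl : ∀ i → ¬ Edge i i
  edge-irrefl i (inj₁ c) = <-irrefl refl (Child⇒< c)
  edge-irrefl i (inj₂ c) = <-irrefl refl (Child⇒< c)

  alternating : ℕ → ℕ
  alternating 0             = 0
  alternating 1             = suc s
  alternating (suc (suc n)) = alternating n

  alternating-suc : ∀ n → alternating (suc n) ≢ alternating n
  alternating-suc 0       ()
  alternating-suc 1       ()
  alternating-suc (suc (suc n)) = alternating-suc n

  alternating< : ∀ n → alternating n < spokes
  alternating< 0             = s≤s z≤n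
  alternating< 1             = ≤-refl
  alternating< (suc (suc n)) = alternating< n

  -- The colour of the edge from c up to its parent (the root 0 has none): spoke c + 1 gets c,
  -- and the tail edges after the last spoke (coloured suc s) alternate 0, suc s, 0, ….
  childColour : ℕ → ℕ
  childColour zero    = 0
  childColour (suc c) with c <? spokes
  ... | yes _ = c
  ... | no _  = alternating (c ∸ spokes)

  childColour< : ∀ {c p} → Child c p → childColour c < spokes
  childColour< {suc c} _ with c <? spokes
  ... | yes c<spokes = c<spokes
  ... | no _         = alternating< (c ∸ spokes)

  sibling-colours : ∀ {c c′ p} → Child c p → Child c′ p → c ≢ c′ → childColour c ≢ childColour c′
  sibling-colours {suc a} {suc b} ca cb c≢c′ with a <? spokes | b <? spokes
  ... | yes _ | yes _   = c≢c′ ∘ cong suc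
  ... | no _  | no _    = ⊥-elim (c≢c′ (cong suc (trans ca (sym cb))))
  ... | yes _ | no b≮   = ⊥-elim (b≮ (subst (_< spokes) (trans ca (sym cb)) (s≤s z≤n)))
  ... | no a≮ | yes _   = ⊥-elim (a≮ (subst (_< spokes) (trans cb (sym ca)) (s≤s z≤n)))

  tail-colours : ∀ {b} → spokes ≤ suc b → childColour (suc (suc b)) ≢ childColour (suc b)
  tail-colours {b} spokes≤ with suc b <? spokes | b <? spokes
  ... | yes b+1< | _     = ⊥-elim (<-irrefl refl (<-≤-trans b+1< spokes≤))
  ... | no _     | yes b<
    with refl ← suc-injective (≤-antisym b< spokes≤) rewrite n∸n≡0 s = λ ()
  ... | no _     | no b≮ rewrite +-∸-assoc 1 (≮⇒≥ b≮) = alternating-suc (b ∸ spokes)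

  parent-colours : ∀ {c p g} → Child c p → Child p g → childColour c ≢ childColour p
  parent-colours {suc a} {suc b} cp _ with refl , spokes≤ ← Child⇒tail {a} cp = tail-colours spokes≤

  -- An edge is coloured by its child end, which is its larger end.
  edgeColour : ℕ → ℕ → ℕ
  edgeColour i j = childColour (i ⊔ j)

  edgeColour-child : ∀ {c p} → Child c p → edgeColour c p ≡ childColour c
  edgeColour-child cp = cong childColour (m≥n⇒m⊔n≡m (<⇒≤ (Child⇒< cp)))

  edgeColour-parent : ∀ {c p} → Child c p → edgeColour p c ≡ childColour c
  edgeColour-parent cp = cong childColour (m≤n⇒m⊔n≡n (<⇒≤ (Child⇒< cp)))

  edgeColour< : ∀ {i j} → Edge i j → edgeColour i j < spokes
  edgeColour< (inj₁ ij) = subst (_< spokes) (sym (edgeColour-child ij)) (childColour< ij)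
  edgeColour< (inj₂ ji) = subst (_< spokes) (sym (edgeColour-parent ji)) (childColour< ji)

  edgeColour-proper : ∀ {i j j′} → Edge i j → Edge i j′ → j ≢ j′ → edgeColour i j ≢ edgeColour i j′
  edgeColour-proper (inj₁ ij) (inj₁ ij′) j≢j′ = ⊥-elim (j≢j′ (Child-unique ij ij′))
  edgeColour-proper (inj₁ ij) (inj₂ j′i) _ eq =
    parent-colours j′i ij (trans (sym (edgeColour-parent j′i)) (trans (sym eq) (edgeColour-child ij)))
  edgeColour-proper (inj₂ ji) (inj₁ ij′) _ eq =
    parent-colours ji ij′ (trans (sym (edgeColour-parent ji)) (trans eq (edgeColour-child ij′)))
  edgeColour-proper (inj₂ ji) (inj₂ j′i) j≢j′ eq =
    sibling-colours ji j′i j≢j′ (trans (sym (edgeColour-parent ji)) (trans eq (edgeColour-parent j′i)))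

  module _ (X : Multigraph) where
    open ClusterIndex X
    open Matching X
    open IndexConstituents X edge? edge-sym edge-irrefl

    broom : Constituents X
    broom = constituents

    broom-cohesive : Cohesive broom
    broom-cohesive = cohesive descend
      where
      descend : ∀ i → 0 < i → ∃ λ j → j < i × Edge i j
      descend (suc c) _ = parent c , s≤s (parent≤ c) , inj₁ refl

    broom-colouring : EdgeColouring (truncation X broom) (suc spokes)
    broom-colouring = truncationColouring
      (colouring edgeColour (λ i j → cong childColour (⊔-comm i j)) edgeColour< edgeColour-proper)

    broom-needs-colours : ∀ v → suc spokes ≤ valency X v →
                          ∀ j → j < suc spokes → ¬ EdgeColouring (truncation X broom) j
    broom-needs-colours v big
      with x₀ , l₀ , i₀ ← index-surjective v (≤-trans (s≤s z≤n) big)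
      = colouring-needs-degree (truncation X broom) x₀ neighbour neighbour-injective adjacent
      where
      spokeEnd : (i : Fin spokes) → ∃ λ y → label X y ≡ v × index y ≡ suc (toℕ i)
      spokeEnd i = index-surjective v (≤-trans (s≤s (toℕ<n i)) big)

      neighbour : Fin (suc spokes) → TVert X
      neighbour zero    = partner x₀
      neighbour (suc i) = proj₁ (spokeEnd i)

      partner≢spokeEnd : ∀ i → partner x₀ ≢ proj₁ (spokeEnd i)
      partner≢spokeEnd i eq =
        label-partner x₀ (trans (cong (label X) eq) (trans (proj₁ (proj₂ (spokeEnd i))) (sym l₀)))

      neighbour-injective : Injective _≡_ _≡_ neighbour
      neighbour-injective {zero}  {zero}  _  = refl
      neighbour-injective {zero}  {suc j} eq = ⊥-elim (partner≢spokeEnd j eq)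
      neighbour-injective {suc i} {zero}  eq = ⊥-elim (partner≢spokeEnd i (sym eq))
      neighbour-injective {suc i} {suc j} eq = cong suc (toℕ-injective (suc-injective
        (trans (sym (proj₂ (proj₂ (spokeEnd i)))) (trans (cong index eq) (proj₂ (proj₂ (spokeEnd j)))))))

      adjacent : ∀ i → truncAdj X broom x₀ (neighbour i) ≡ true
      adjacent zero    = cong (_∨ con broom x₀ (partner x₀)) (matchAdj-partner x₀)
      adjacent (suc i) = spoke-adjacent (spokeEnd i)
        where
        spoke-adjacent : (end : ∃ λ y → label X y ≡ v × index y ≡ suc (toℕ i)) →
                         truncAdj X broom x₀ (proj₁ end) ≡ true
        spoke-adjacent (y , ly , iy) =
          trans (cong (matchAdj X x₀ y ∨_) (dec-true (linked? x₀ y) (trans l₀ (sym ly) , edge)))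
                (∨-zeroʳ (matchAdj X x₀ y))
          where
          edge : Edge (index x₀) (index y)
          edge = subst₂ Edge (sym i₀) (sym iy) (inj₂ (spoke (toℕ<n i)))

    broom-chromaticIndex : ∀ v → suc spokes ≤ valency X v → ChromaticIndex (truncation X broom) (suc spokes)
    broom-chromaticIndex v big = broom-colouring , broom-needs-colours v big

theorem7p3 : (X : Multigraph) (d : ℕ) → MaxValency X d → 2 < d →
    (D : ℕ) → ChromaticIndex (completeTruncation X) D →
    (k : ℕ) → 3 ≤ k → k ≤ D →
    Σ (Constituents X) (λ C → Cohesive C × ChromaticIndex (truncation X C) k)
theorem7p3 X d@(suc _) (valency≤d , v , valency≡d) (s≤s _) D χD@(_ , minimalD)
           k@(suc (suc (suc s))) (s≤s (s≤s (s≤s _))) k≤D with k ≤? d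
... | yes k≤d = broom X , broom-cohesive X , broom-chromaticIndex X v k≤valency
  where
  open Broom s
  k≤valency : k ≤ valency X v
  k≤valency = subst (k ≤_) (sym valency≡d) k≤d
... | no k≰d = complete X , complete-cohesive X , subst (ChromaticIndex (completeTruncation X)) D≡k χD
  where
  D≤d+1 : D ≤ suc d
  D≤d+1 = ≮⇒≥ (λ d+1<D → minimalD (suc d) d+1<D (completeTruncation-colouring X valency≤d))

  D≡k : D ≡ k
  D≡k = ≤-antisym (≤-trans D≤d+1 (≰⇒> k≰d)) k≤D
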